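{- Let $\Gamma$ be a connected weighted graph with weighted Laplacian $L$. Then the firing script $\sigma$ defined by $\sigma(v) = c(v)$ for all $v\in V(\Gamma)$ generates $\ker(L)$ (as a subgroup of $\mathbb{Z}^{V(\Gamma)}$), i.e. $L\sigma=\mathbf{0}$ and every integer script $\sigma'$ with $L\sigma'=\mathbf{0}$ is an integer multiple of $\sigma$.
   Context: A weighted graph $\Gamma$ is a finite connected multigraph without loops, with vertex set $V(\Gamma)$, edge set $E(\Gamma)$, and weights $w: V(\Gamma)\cup E(\Gamma)\to\mathbb{Z}_{>0}$ such that the weight of each edge divides the weights of both of its endpoints. $E(v)$ denotes the set of edges incident to $v$ and $E(u,v)$ the set of edges joining $u$ and $v$. The weighted valency is $\mathrm{val}(v)=\sum_{e\in E(v)} w(v)/w(e)$. A firing script is a function $\sigma: V(\Gamma)\to\mathbb{Z}$. With vertices $v_1,\dots,v_n$, the weighted Laplacian is the $n\times n$ integer matrix $L$ with $L_{ii}=\mathrm{val}(v_i)$ and $L_{ij} = -\sum_{e\in E(v_i,v_j)} w(v_j)/w(e)$ for $i\neq j$. The charge of a vertex $v$ is $c(v) = \mathrm{lcm}(w(v_1),\dots,w(v_n))/w(v)$. -}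

module Defs where

open import Data.Nat using (ℕ; zero; suc; NonZero)
open import Data.Nat.Divisibility using (_∣_)
open import Data.Nat.DivMod using (_/_)
import Data.Nat
open import Data.Nat.LCM using (lcm)
open import Data.Integer as ℤ using (ℤ; +_)
open import Data.Fin using (Fin)
open import Data.Fin.Properties using () renaming (_≟_ to _≟ᶠ_)
open import Data.List using (List; map; foldr; allFin)
open import Data.List.Relation.Unary.All using (All)
open import Data.List.Relation.Unary.Any using (Any)
open import Data.Product using (_×_)
open import Data.Sum using (_⊎_)
open import Relation.Binary.PropositionalEquality using (_≡_; _≢_)
open import Relation.Nullary using (yes; no; Dec)
open import Relation.Nullary.Decidable using (⌊_⌋)
open import Data.Bool using (Bool; true; false; if_then_else_; _∧_; _∨_)

-- An edge of a multigraph on vertex set Fin n, with its weight.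
-- The orientation (src, tgt) is irrelevant: the edge joins src and tgt.
record Edge (n : ℕ) : Set where
  constructor edge
  field
    src tgt : Fin n
    ew      : ℕ

open Edge public

Adjacent : ∀ {n} → List (Edge n) → Fin n → Fin n → Set
Adjacent es u v = Any (λ e → (src e ≡ u × tgt e ≡ v) ⊎ (src e ≡ v × tgt e ≡ u)) es

data Reachable {n : ℕ} (es : List (Edge n)) : Fin n → Fin n → Set where
  here : ∀ {u} → Reachable es u u
  step : ∀ {u v w} → Adjacent es u v → Reachable es v w → Reachable es u w

record WeightedGraph : Set where
  field
    n          : ℕ
    vw         : Fin n → ℕ
    edges      : List (Edge n)
    vw-pos     : ∀ v → NonZero (vw v)
    ew-pos     : All (λ e → NonZero (ew e)) edges
    noLoops    : All (λ e → src e ≢ tgt e) edges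
    ew∣src     : All (λ e → ew e ∣ vw (src e)) edges
    ew∣tgt     : All (λ e → ew e ∣ vw (tgt e)) edges
    connected  : ∀ u v → Reachable edges u v

module _ (Γ : WeightedGraph) where
  open WeightedGraph Γ

  -- w(v)/w(e)  (edge weight positive; 0 returned only in the impossible case w(e)=0)
  ratio : Fin n → Edge n → ℕ
  ratio v e with ew e
  ... | zero  = 0
  ... | suc k = vw v / suc k

  isIncident : Fin n → Edge n → Bool
  isIncident v e = ⌊ src e ≟ᶠ v ⌋ ∨ ⌊ tgt e ≟ᶠ v ⌋

  joins : Fin n → Fin n → Edge n → Bool
  joins u v e = (⌊ src e ≟ᶠ u ⌋ ∧ ⌊ tgt e ≟ᶠ v ⌋) ∨ (⌊ src e ≟ᶠ v ⌋ ∧ ⌊ tgt e ≟ᶠ u ⌋)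

  sumℕ : List ℕ → ℕ
  sumℕ = foldr Data.Nat._+_ 0

  val : Fin n → ℕ
  val v = sumℕ (map (λ e → if isIncident v e then ratio v e else 0) edges)

  offDiag : Fin n → Fin n → ℕ
  offDiag u v = sumℕ (map (λ e → if joins u v e then ratio v e else 0) edges)

  laplacian : Fin n → Fin n → ℤ
  laplacian i j with i ≟ᶠ j
  ... | yes _ = + val i
  ... | no  _ = ℤ.- (+ offDiag i j)

  sumℤ : List ℤ → ℤ
  sumℤ = foldr ℤ._+_ (+ 0)

  applyL : (Fin n → ℤ) → Fin n → ℤ
  applyL σ i = sumℤ (map (λ j → laplacian i j ℤ.* σ j) (allFin n))

  lcmWeights : ℕ
  lcmWeights = foldr lcm 1 (map vw (allFin n))

  charge : Fin n → ℕ
  charge v = _/_ lcmWeights (vw v) {{vw-pos v}}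

{-# OPTIONS --safe #-}
-- Each edge e contributes to L the rank-one matrix dₑ (dₑ ∘ rₑ)ᵀ, where dₑ = 1_{src e} − 1_{tgt e}
-- and rₑ(v) = w(v)/w(e). Hence (Lσ)(v) = Σₑ dₑ(v) gₑ(σ) with gₑ(σ) = (rₑ σ)(src e) − (rₑ σ)(tgt e),
-- and w(e) gₑ(σ) = F(src e) − F(tgt e) for the potential F(v) = w(v) σ(v). The charge has constant
-- potential lcm(w), so every gₑ vanishes and L c = 0. Conversely Σᵥ F(v) (Lσ)(v) = Σₑ w(e) gₑ(σ)²,
-- so Lσ = 0 forces every gₑ to vanish: F is constant along edges, hence constant by connectivity,
-- the lcm divides its value, and σ is the quotient times c.
module Submission where

open import Defs
open import Algebra.Bundles using (Monoid)
import Algebra.Properties.Monoid.Sum as MonoidSum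
import Algebra.Properties.Semiring.Sum as SemiringSum
open import Data.Bool using (Bool; true; false; if_then_else_)
open import Data.Empty using (⊥-elim)
open import Data.Fin using (Fin; zero; suc)
open import Data.Fin.Properties using (_≟_)
open import Data.Integer using (ℤ; +_; -[1+_]; _+_; _-_; -_; _*_; ∣_∣)
import Data.Integer.Properties as ℤP
open import Data.Integer.Divisibility.Signed using (∣ᵤ⇒∣; divides) renaming (_∣_ to _∣ℤ_)
open import Data.Integer.Tactic.RingSolver using (solve-∀)
open import Data.List using (List; []; _∷_; map; foldr; tabulate; allFin; length; lookup)
open import Data.List.Membership.Propositional using (_∈_)
open import Data.List.Membership.Propositional.Properties using (∈-lookup; ∈-map⁺; ∈-allFin)
open import Data.List.Relation.Unary.All as All using (All; []; _∷_)
open import Data.List.Relation.Unary.All.Properties using (map⁺; tabulate⁺)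
open import Data.List.Relation.Unary.Any using (here; there; index)
open import Data.List.Relation.Unary.Any.Properties using (lookup-index)
open import Data.Nat as ℕ using (ℕ; NonZero)
import Data.Nat.Properties as ℕP
open import Data.Nat.Divisibility using (_∣_; ∣-trans; 1∣_; m∣m*n)
open import Data.Nat.DivMod using (_/_; m/n*n≡m; m*[n/m]≡n)
open import Data.Nat.LCM using (lcm; m∣lcm[m,n]; n∣lcm[m,n]; lcm-least)
open import Data.Product using (_×_; ∃; _,_)
open import Data.Sum using (inj₁; inj₂; [_,_]′)
open import Function using (_∘_; id)
open import Relation.Binary.PropositionalEquality
open import Relation.Nullary using (yes; no)
open import Relation.Nullary.Decidable using (⌊_⌋)

open SemiringSum ℤP.+-*-semiring
  using (sum; sum-syntax; sum-cong-≗; sum-replicate-zero; ∑-comm; ∑-distrib-+; *-distribˡ-sum; *-distribʳ-sum)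
module ℕΣ = MonoidSum ℕP.+-0-monoid

module _ {c ℓ} (M : Monoid c ℓ) where
  open Monoid M using (Carrier; _≈_; _∙_; ε; ∙-congˡ) renaming (refl to ≈-refl)
  open MonoidSum M renaming (sum to ∑)

  foldr-map≈sum-lookup : ∀ {a} {A : Set a} (h : A → Carrier) (xs : List A) →
                         foldr _∙_ ε (map h xs) ≈ ∑ (h ∘ lookup xs)
  foldr-map≈sum-lookup h []       = ≈-refl
  foldr-map≈sum-lookup h (x ∷ xs) = ∙-congˡ (foldr-map≈sum-lookup h xs)

  foldr-map-tabulate≈sum : ∀ {a} {A : Set a} {n} (h : A → Carrier) (f : Fin n → A) →
                           foldr _∙_ ε (map h (tabulate f)) ≈ ∑ (h ∘ f)
  foldr-map-tabulate≈sum {n = ℕ.zero}  h f = ≈-refl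
  foldr-map-tabulate≈sum {n = ℕ.suc n} h f = ∙-congˡ (foldr-map-tabulate≈sum h (f ∘ suc))

sum≡0 : ∀ {n} {f : Fin n → ℤ} → (∀ i → f i ≡ + 0) → sum f ≡ + 0
sum≡0 {n} f≡0 = trans (sum-cong-≗ f≡0) (sum-replicate-zero n)

pos-sum : ∀ {n} (f : Fin n → ℕ) → + ℕΣ.sum f ≡ ∑[ i < n ] (+ f i)
pos-sum {ℕ.zero}  f = refl
pos-sum {ℕ.suc n} f = trans (ℤP.pos-+ (f zero) _) (cong (_+_ (+ f zero)) (pos-sum (f ∘ suc)))

neg-sum : ∀ {n} (f : Fin n → ℤ) → - sum f ≡ ∑[ i < n ] (- f i)
neg-sum {ℕ.zero}  f = refl
neg-sum {ℕ.suc n} f = trans (ℤP.neg-distrib-+ (f zero) _) (cong (_+_ (- f zero)) (neg-sum (f ∘ suc)))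

sum≡0⇒≡0 : ∀ {n} (f : Fin n → ℕ) → ℕΣ.sum f ≡ 0 → ∀ i → f i ≡ 0
sum≡0⇒≡0 f eq zero    = ℕP.m+n≡0⇒m≡0 (f zero) eq
sum≡0⇒≡0 f eq (suc i) = sum≡0⇒≡0 (f ∘ suc) (ℕP.m+n≡0⇒n≡0 (f zero) eq) i

i*i≡+∣i∣*∣i∣ : ∀ i → i * i ≡ + (∣ i ∣ ℕ.* ∣ i ∣)
i*i≡+∣i∣*∣i∣ (+ m)    = sym (ℤP.pos-* m m)
i*i≡+∣i∣*∣i∣ -[1+ m ] = ℤP.+◃n≡+n _

𝟙 : Bool → ℤ
𝟙 b = if b then + 1 else + 0

if≡𝟙* : ∀ b r → + (if b then r else 0) ≡ 𝟙 b * + r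
if≡𝟙* true  r = sym (ℤP.*-identityˡ (+ r))
if≡𝟙* false r = refl

δ : ∀ {n} → Fin n → Fin n → ℤ
δ u v = 𝟙 ⌊ u ≟ v ⌋

δ-suc : ∀ {n} (u v : Fin n) → δ (suc u) (suc v) ≡ δ u v
δ-suc u v with u ≟ v
... | yes _ = refl
... | no  _ = refl

∑-δ : ∀ {n} (u : Fin n) (f : Fin n → ℤ) → ∑[ v < n ] (δ u v * f v) ≡ f u
∑-δ {ℕ.suc n} zero    f = trans
  (cong₂ _+_ (ℤP.*-identityˡ (f zero)) (sum≡0 (λ v → ℤP.*-zeroˡ (f (suc v)))))
  (ℤP.+-identityʳ (f zero))
∑-δ {ℕ.suc n} (suc u) f = begin
  + 0 * f zero + ∑[ v < n ] (δ (suc u) (suc v) * f (suc v))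
    ≡⟨ cong₂ _+_ (ℤP.*-zeroˡ (f zero)) (sum-cong-≗ (λ v → cong (_* f (suc v)) (δ-suc u v))) ⟩
  + 0 + ∑[ v < n ] (δ u v * f (suc v))
    ≡⟨ ℤP.+-identityˡ _ ⟩
  ∑[ v < n ] (δ u v * f (suc v))
    ≡⟨ ∑-δ u (f ∘ suc) ⟩
  f (suc u) ∎
  where open ≡-Reasoning

incidence : ∀ {n} → Edge n → Fin n → ℤ
incidence e v = δ (src e) v - δ (tgt e) v

∑-incidence : ∀ {n} (e : Edge n) (f : Fin n → ℤ) →
              ∑[ v < n ] (incidence e v * f v) ≡ f (src e) - f (tgt e)
∑-incidence {n} e f = begin
  ∑[ v < n ] (incidence e v * f v)
    ≡⟨ sum-cong-≗ (λ v → [a-b]*x≡a*x+b*[-x] (δ s v) (δ t v) (f v)) ⟩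
  ∑[ v < n ] (δ s v * f v + δ t v * - f v)
    ≡⟨ ∑-distrib-+ (λ v → δ s v * f v) (λ v → δ t v * - f v) ⟩
  ∑[ v < n ] (δ s v * f v) + ∑[ v < n ] (δ t v * - f v)
    ≡⟨ cong₂ _+_ (∑-δ s f) (∑-δ t (-_ ∘ f)) ⟩
  f s - f t ∎
  where
  open ≡-Reasoning
  s = src e
  t = tgt e
  [a-b]*x≡a*x+b*[-x] : ∀ a b x → (a - b) * x ≡ a * x + b * - x
  [a-b]*x≡a*x+b*[-x] = solve-∀

x∈xs⇒x∣foldr-lcm : ∀ {x xs} → x ∈ xs → x ∣ foldr lcm 1 xs
x∈xs⇒x∣foldr-lcm (here refl)             = m∣lcm[m,n] _ _
x∈xs⇒x∣foldr-lcm {xs = y ∷ _} (there p) = ∣-trans (x∈xs⇒x∣foldr-lcm p) (n∣lcm[m,n] y _)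

foldr-lcm-least : ∀ {xs c} → All (_∣ c) xs → foldr lcm 1 xs ∣ c
foldr-lcm-least []       = 1∣ _
foldr-lcm-least (p ∷ ps) = lcm-least p (foldr-lcm-least ps)

-- charge Γ is definitionally cofactor vw vw-pos.
cofactor : ∀ {n} (w : Fin n → ℕ) → (∀ v → NonZero (w v)) → Fin n → ℕ
cofactor {n} w w-pos v = _/_ (foldr lcm 1 (map w (allFin n))) (w v) {{w-pos v}}

w*cofactor≡lcm : ∀ {n} (w : Fin n → ℕ) (w-pos : ∀ v → NonZero (w v)) v →
                 w v ℕ.* cofactor w w-pos v ≡ foldr lcm 1 (map w (allFin n))
w*cofactor≡lcm w w-pos v = m*[n/m]≡n {{w-pos v}} (x∈xs⇒x∣foldr-lcm (∈-map⁺ w (∈-allFin v)))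

lcm∣common-product : ∀ {n} (w : Fin n → ℕ) (σ : Fin n → ℤ) C →
                     (∀ v → + w v * σ v ≡ C) → + foldr lcm 1 (map w (allFin n)) ∣ℤ C
lcm∣common-product w σ C w*σ≡C = ∣ᵤ⇒∣ (foldr-lcm-least (map⁺ (tabulate⁺ w∣∣C∣)))
  where
  w∣∣C∣ : ∀ v → w v ∣ ∣ C ∣
  w∣∣C∣ v = subst (w v ∣_) (trans (sym (ℤP.abs-* (+ w v) (σ v))) (cong ∣_∣ (w*σ≡C v))) (m∣m*n ∣ σ v ∣)

multiple-of-cofactor : ∀ {n} (w : Fin n → ℕ) (w-pos : ∀ v → NonZero (w v)) (σ : Fin n → ℤ) C →
                       (∀ v → + w v * σ v ≡ C) → ∃ λ k → ∀ v → σ v ≡ k * + cofactor w w-pos v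
multiple-of-cofactor {n} w w-pos σ C w*σ≡C with lcm∣common-product w σ C w*σ≡C
... | divides k C≡k*L = k , λ v → ℤP.*-cancelˡ-≡ (+ w v) _ _ {{w-pos v}} (begin
  + w v * σ v                                 ≡⟨ w*σ≡C v ⟩
  C                                           ≡⟨ C≡k*L ⟩
  k * + foldr lcm 1 (map w (allFin n))        ≡⟨ cong (λ x → k * + x) (w*cofactor≡lcm w w-pos v) ⟨
  k * + (w v ℕ.* cofactor w w-pos v)          ≡⟨ cong (k *_) (ℤP.pos-* (w v) _) ⟩
  k * (+ w v * + cofactor w w-pos v)          ≡⟨ x*[y*z]≡y*[x*z] k (+ w v) _ ⟩
  + w v * (k * + cofactor w w-pos v)          ∎)
  where
  open ≡-Reasoning
  x*[y*z]≡y*[x*z] : ∀ x y z → x * (y * z) ≡ y * (x * z)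
  x*[y*z]≡y*[x*z] = solve-∀

constant-product⇒multiple-of-cofactor :
  ∀ {n} (w : Fin n → ℕ) (w-pos : ∀ v → NonZero (w v)) (σ : Fin n → ℤ) →
  (∀ u v → + w u * σ u ≡ + w v * σ v) → ∃ λ k → ∀ v → σ v ≡ k * + cofactor w w-pos v
constant-product⇒multiple-of-cofactor {ℕ.zero}  w w-pos σ _     = + 0 , λ ()
constant-product⇒multiple-of-cofactor {ℕ.suc n} w w-pos σ const = multiple-of-cofactor w w-pos σ _ (λ v → const v zero)

module _ {n} {A : Set} {es : List (Edge n)} (F : Fin n → A)
         (F-edge : ∀ k → F (src (lookup es k)) ≡ F (tgt (lookup es k))) where

  Adjacent⇒≡ : ∀ {u v} → Adjacent es u v → F u ≡ F v
  Adjacent⇒≡ a with lookup-index a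
  ... | inj₁ (s≡u , t≡v) = trans (cong F (sym s≡u)) (trans (F-edge (index a)) (cong F t≡v))
  ... | inj₂ (s≡v , t≡u) = trans (cong F (sym t≡u)) (trans (sym (F-edge (index a))) (cong F s≡v))

  Reachable⇒≡ : ∀ {u v} → Reachable es u v → F u ≡ F v
  Reachable⇒≡ here       = refl
  Reachable⇒≡ (step a r) = trans (Adjacent⇒≡ a) (Reachable⇒≡ r)

module _ (Γ : WeightedGraph) where
  open WeightedGraph Γ

  m : ℕ
  m = length edges

  edgeAt : Fin m → Edge n
  edgeAt = lookup edges

  at : ∀ {P : Edge n → Set} → All P edges → ∀ k → P (edgeAt k)
  at ps k = All.lookup ps (∈-lookup k)

  incidence² : ∀ e i → src e ≢ tgt e → incidence e i * incidence e i ≡ 𝟙 (isIncident Γ i e)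
  incidence² e i s≢t with src e ≟ i | tgt e ≟ i
  ... | yes s≡i | yes t≡i = ⊥-elim (s≢t (trans s≡i (sym t≡i)))
  ... | yes _   | no  _   = refl
  ... | no  _   | yes _   = refl
  ... | no  _   | no  _   = refl

  incidence-product : ∀ e {i j} → src e ≢ tgt e → i ≢ j →
                      incidence e i * incidence e j ≡ - 𝟙 (joins Γ i j e)
  incidence-product e {i} {j} s≢t i≢j with src e ≟ i | tgt e ≟ i | src e ≟ j | tgt e ≟ j
  ... | yes s≡i | yes t≡i | _       | _       = ⊥-elim (s≢t (trans s≡i (sym t≡i)))
  ... | _       | _       | yes s≡j | yes t≡j = ⊥-elim (s≢t (trans s≡j (sym t≡j)))
  ... | yes s≡i | _       | yes s≡j | _       = ⊥-elim (i≢j (trans (sym s≡i) s≡j))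
  ... | _       | yes t≡i | _       | yes t≡j = ⊥-elim (i≢j (trans (sym t≡i) t≡j))
  ... | yes _   | no _    | no _    | yes _   = refl
  ... | yes _   | no _    | no _    | no _    = refl
  ... | no _    | yes _   | yes _   | no _    = refl
  ... | no _    | yes _   | no _    | no _    = refl
  ... | no _    | no _    | yes _   | no _    = refl
  ... | no _    | no _    | no _    | yes _   = refl
  ... | no _    | no _    | no _    | no _    = refl

  if-incident≡ : ∀ e i → src e ≢ tgt e →
                 + (if isIncident Γ i e then ratio Γ i e else 0) ≡ incidence e i * incidence e i * + ratio Γ i e
  if-incident≡ e i s≢t =
    trans (if≡𝟙* (isIncident Γ i e) (ratio Γ i e)) (cong (_* + ratio Γ i e) (sym (incidence² e i s≢t)))

  -if-joins≡ : ∀ e {i j} → src e ≢ tgt e → i ≢ j →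
               - + (if joins Γ i j e then ratio Γ j e else 0) ≡ incidence e i * incidence e j * + ratio Γ j e
  -if-joins≡ e {i} {j} s≢t i≢j = begin
    - + (if joins Γ i j e then ratio Γ j e else 0) ≡⟨ cong -_ (if≡𝟙* (joins Γ i j e) (ratio Γ j e)) ⟩
    - (𝟙 (joins Γ i j e) * + ratio Γ j e)          ≡⟨ ℤP.neg-distribˡ-* (𝟙 (joins Γ i j e)) (+ ratio Γ j e) ⟩
    - 𝟙 (joins Γ i j e) * + ratio Γ j e            ≡⟨ cong (_* + ratio Γ j e) (incidence-product e s≢t i≢j) ⟨
    incidence e i * incidence e j * + ratio Γ j e  ∎
    where open ≡-Reasoning

  +sumℕ-edges : ∀ (h : Edge n → ℕ) → + sumℕ Γ (map h edges) ≡ ∑[ k < m ] (+ h (edgeAt k))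
  +sumℕ-edges h = trans (cong +_ (foldr-map≈sum-lookup ℕP.+-0-monoid h edges)) (pos-sum (h ∘ edgeAt))

  laplacian≡∑ : ∀ i j →
                laplacian Γ i j ≡ ∑[ k < m ] (incidence (edgeAt k) i * incidence (edgeAt k) j * + ratio Γ j (edgeAt k))
  laplacian≡∑ i j with i ≟ j
  ... | yes refl = begin
    + val Γ i
      ≡⟨ +sumℕ-edges (λ e → if isIncident Γ i e then ratio Γ i e else 0) ⟩
    ∑[ k < m ] (+ (if isIncident Γ i (edgeAt k) then ratio Γ i (edgeAt k) else 0))
      ≡⟨ sum-cong-≗ (λ k → if-incident≡ (edgeAt k) i (at noLoops k)) ⟩
    ∑[ k < m ] (incidence (edgeAt k) i * incidence (edgeAt k) i * + ratio Γ i (edgeAt k)) ∎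
    where open ≡-Reasoning
  ... | no i≢j = begin
    - + offDiag Γ i j
      ≡⟨ cong -_ (+sumℕ-edges (λ e → if joins Γ i j e then ratio Γ j e else 0)) ⟩
    - ∑[ k < m ] (+ (if joins Γ i j (edgeAt k) then ratio Γ j (edgeAt k) else 0))
      ≡⟨ neg-sum (λ k → + (if joins Γ i j (edgeAt k) then ratio Γ j (edgeAt k) else 0)) ⟩
    ∑[ k < m ] (- + (if joins Γ i j (edgeAt k) then ratio Γ j (edgeAt k) else 0))
      ≡⟨ sum-cong-≗ (λ k → -if-joins≡ (edgeAt k) (at noLoops k) i≢j) ⟩
    ∑[ k < m ] (incidence (edgeAt k) i * incidence (edgeAt k) j * + ratio Γ j (edgeAt k)) ∎
    where open ≡-Reasoning

  gradient : Fin m → (Fin n → ℤ) → ℤ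
  gradient k σ = + ratio Γ (src e) e * σ (src e) - + ratio Γ (tgt e) e * σ (tgt e)
    where e = edgeAt k

  applyL≡∑ : ∀ σ i → applyL Γ σ i ≡ ∑[ k < m ] (incidence (edgeAt k) i * gradient k σ)
  applyL≡∑ σ i = begin
    applyL Γ σ i
      ≡⟨ foldr-map-tabulate≈sum ℤP.+-0-monoid (λ j → laplacian Γ i j * σ j) id ⟩
    ∑[ j < n ] (laplacian Γ i j * σ j)
      ≡⟨ sum-cong-≗ (λ j → cong (_* σ j) (laplacian≡∑ i j)) ⟩
    ∑[ j < n ] (∑[ k < m ] (d k i * d k j * r k j) * σ j)
      ≡⟨ sum-cong-≗ (λ j → *-distribʳ-sum (σ j) (λ k → d k i * d k j * r k j)) ⟩
    ∑[ j < n ] ∑[ k < m ] (d k i * d k j * r k j * σ j)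
      ≡⟨ ∑-comm (λ j k → d k i * d k j * r k j * σ j) ⟩
    ∑[ k < m ] ∑[ j < n ] (d k i * d k j * r k j * σ j)
      ≡⟨ sum-cong-≗ (λ k → sum-cong-≗ (λ j → reassociate (d k i) (d k j) (r k j) (σ j))) ⟩
    ∑[ k < m ] ∑[ j < n ] (d k i * (d k j * (r k j * σ j)))
      ≡⟨ sum-cong-≗ (λ k → *-distribˡ-sum (d k i) (λ j → d k j * (r k j * σ j))) ⟨
    ∑[ k < m ] (d k i * ∑[ j < n ] (d k j * (r k j * σ j)))
      ≡⟨ sum-cong-≗ (λ k → cong (d k i *_) (∑-incidence (edgeAt k) (λ j → r k j * σ j))) ⟩
    ∑[ k < m ] (d k i * gradient k σ) ∎
    where
    open ≡-Reasoning
    d : Fin m → Fin n → ℤ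
    d k = incidence (edgeAt k)
    r : Fin m → Fin n → ℤ
    r k j = + ratio Γ j (edgeAt k)
    reassociate : ∀ a b c x → a * b * c * x ≡ a * (b * (c * x))
    reassociate = solve-∀

  ratio*ew≡vw : ∀ e v → NonZero (ew e) → ew e ∣ vw v → ratio Γ v e ℕ.* ew e ≡ vw v
  ratio*ew≡vw (edge _ _ (ℕ.suc _)) v _ ew∣vw = m/n*n≡m ew∣vw

  potential : (Fin n → ℤ) → Fin n → ℤ
  potential σ v = + vw v * σ v

  ew*gradient : ∀ k σ →
                + ew (edgeAt k) * gradient k σ ≡ potential σ (src (edgeAt k)) - potential σ (tgt (edgeAt k))
  ew*gradient k σ = begin
    w * (+ ratio Γ s e * σ s - + ratio Γ t e * σ t)
      ≡⟨ distribute w (+ ratio Γ s e) (σ s) (+ ratio Γ t e) (σ t) ⟩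
    + ratio Γ s e * w * σ s - + ratio Γ t e * w * σ t
      ≡⟨ cong₂ (λ a b → a * σ s - b * σ t) (ratio*w≡vw s (at ew∣src k)) (ratio*w≡vw t (at ew∣tgt k)) ⟩
    + vw s * σ s - + vw t * σ t ∎
    where
    open ≡-Reasoning
    e = edgeAt k
    s = src e
    t = tgt e
    w = + ew e
    distribute : ∀ w a x b y → w * (a * x - b * y) ≡ a * w * x - b * w * y
    distribute = solve-∀
    ratio*w≡vw : ∀ v → ew e ∣ vw v → + ratio Γ v e * w ≡ + vw v
    ratio*w≡vw v ew∣vw =
      trans (sym (ℤP.pos-* (ratio Γ v e) (ew e))) (cong +_ (ratio*ew≡vw e v (at ew-pos k) ew∣vw))

  gradient≡0⇒potential≡ : ∀ k σ → gradient k σ ≡ + 0 →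
                          potential σ (src (edgeAt k)) ≡ potential σ (tgt (edgeAt k))
  gradient≡0⇒potential≡ k σ g≡0 = ℤP.i-j≡0⇒i≡j _ _ (begin
    potential σ (src (edgeAt k)) - potential σ (tgt (edgeAt k)) ≡⟨ ew*gradient k σ ⟨
    + ew (edgeAt k) * gradient k σ                              ≡⟨ cong (+ ew (edgeAt k) *_) g≡0 ⟩
    + ew (edgeAt k) * + 0                                       ≡⟨ ℤP.*-zeroʳ (+ ew (edgeAt k)) ⟩
    + 0                                                         ∎)
    where open ≡-Reasoning

  potential≡⇒gradient≡0 : ∀ k σ → potential σ (src (edgeAt k)) ≡ potential σ (tgt (edgeAt k)) →
                          gradient k σ ≡ + 0
  potential≡⇒gradient≡0 k σ F≡ =
    ℤP.*-cancelˡ-≡ (+ ew (edgeAt k)) _ (+ 0) {{at ew-pos k}} (begin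
    + ew (edgeAt k) * gradient k σ                              ≡⟨ ew*gradient k σ ⟩
    potential σ (src (edgeAt k)) - potential σ (tgt (edgeAt k)) ≡⟨ cong (_- potential σ (tgt (edgeAt k))) F≡ ⟩
    potential σ (tgt (edgeAt k)) - potential σ (tgt (edgeAt k)) ≡⟨ ℤP.+-inverseʳ (potential σ (tgt (edgeAt k))) ⟩
    + 0                                                         ≡⟨ ℤP.*-zeroʳ (+ ew (edgeAt k)) ⟨
    + ew (edgeAt k) * + 0                                       ∎)
    where open ≡-Reasoning

  Harmonic : (Fin n → ℤ) → Set
  Harmonic σ = ∀ v → applyL Γ σ v ≡ + 0

  charge-harmonic : Harmonic (λ v → + charge Γ v)
  charge-harmonic i = trans (applyL≡∑ c i) (sum≡0 λ k → begin
    incidence (edgeAt k) i * gradient k c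
      ≡⟨ cong (incidence (edgeAt k) i *_) (potential≡⇒gradient≡0 k c (potential-c-constant _ _)) ⟩
    incidence (edgeAt k) i * + 0
      ≡⟨ ℤP.*-zeroʳ (incidence (edgeAt k) i) ⟩
    + 0 ∎)
    where
    open ≡-Reasoning
    c : Fin n → ℤ
    c v = + charge Γ v
    potential-c-constant : ∀ u v → potential c u ≡ potential c v
    potential-c-constant u v = begin
      + vw u * + charge Γ u   ≡⟨ ℤP.pos-* (vw u) (charge Γ u) ⟨
      + (vw u ℕ.* charge Γ u) ≡⟨ cong +_ (trans (w*cofactor≡lcm vw vw-pos u) (sym (w*cofactor≡lcm vw vw-pos v))) ⟩
      + (vw v ℕ.* charge Γ v) ≡⟨ ℤP.pos-* (vw v) (charge Γ v) ⟩
      + vw v * + charge Γ v   ∎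

  -- w(e) gₑ(σ)², kept in ℕ so that a vanishing sum of these forces each of them to vanish.
  dissipation : (Fin n → ℤ) → Fin m → ℕ
  dissipation σ k = ∣ gradient k σ ∣ ℕ.* ∣ gradient k σ ∣ ℕ.* ew (edgeAt k)

  energy : ∀ σ → ∑[ v < n ] (potential σ v * applyL Γ σ v) ≡ + ℕΣ.sum (dissipation σ)
  energy σ = begin
    ∑[ v < n ] (F v * applyL Γ σ v)
      ≡⟨ sum-cong-≗ (λ v → cong (F v *_) (applyL≡∑ σ v)) ⟩
    ∑[ v < n ] (F v * ∑[ k < m ] (d k v * g k))
      ≡⟨ sum-cong-≗ (λ v → *-distribˡ-sum (F v) (λ k → d k v * g k)) ⟩
    ∑[ v < n ] ∑[ k < m ] (F v * (d k v * g k))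
      ≡⟨ sum-cong-≗ (λ v → sum-cong-≗ (λ k → x*[y*z]≡y*x*z (F v) (d k v) (g k))) ⟩
    ∑[ v < n ] ∑[ k < m ] (d k v * F v * g k)
      ≡⟨ ∑-comm (λ v k → d k v * F v * g k) ⟩
    ∑[ k < m ] ∑[ v < n ] (d k v * F v * g k)
      ≡⟨ sum-cong-≗ (λ k → *-distribʳ-sum (g k) (λ v → d k v * F v)) ⟨
    ∑[ k < m ] (∑[ v < n ] (d k v * F v) * g k)
      ≡⟨ sum-cong-≗ (λ k → cong (_* g k) (∑-incidence (edgeAt k) F)) ⟩
    ∑[ k < m ] ((F (src (edgeAt k)) - F (tgt (edgeAt k))) * g k)
      ≡⟨ sum-cong-≗ potential-drop*gradient ⟩
    ∑[ k < m ] (+ dissipation σ k)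
      ≡⟨ pos-sum (dissipation σ) ⟨
    + ℕΣ.sum (dissipation σ) ∎
    where
    open ≡-Reasoning
    F = potential σ
    g : Fin m → ℤ
    g k = gradient k σ
    d : Fin m → Fin n → ℤ
    d k = incidence (edgeAt k)
    x*[y*z]≡y*x*z : ∀ x y z → x * (y * z) ≡ y * x * z
    x*[y*z]≡y*x*z = solve-∀
    x*y*y≡y*y*x : ∀ x y → x * y * y ≡ y * y * x
    x*y*y≡y*y*x = solve-∀
    potential-drop*gradient : ∀ k → (F (src (edgeAt k)) - F (tgt (edgeAt k))) * g k ≡ + dissipation σ k
    potential-drop*gradient k = begin
      (F (src (edgeAt k)) - F (tgt (edgeAt k))) * g k ≡⟨ cong (_* g k) (ew*gradient k σ) ⟨
      + ew (edgeAt k) * g k * g k                     ≡⟨ x*y*y≡y*y*x (+ ew (edgeAt k)) (g k) ⟩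
      g k * g k * + ew (edgeAt k)                     ≡⟨ cong (_* + ew (edgeAt k)) (i*i≡+∣i∣*∣i∣ (g k)) ⟩
      + (∣ g k ∣ ℕ.* ∣ g k ∣) * + ew (edgeAt k)       ≡⟨ ℤP.pos-* (∣ g k ∣ ℕ.* ∣ g k ∣) (ew (edgeAt k)) ⟨
      + dissipation σ k                               ∎

  harmonic⇒gradient≡0 : ∀ σ → Harmonic σ → ∀ k → gradient k σ ≡ + 0
  harmonic⇒gradient≡0 σ harmonic k =
    ℤP.∣i∣≡0⇒i≡0 ([ id , id ]′ (ℕP.m*n≡0⇒m≡0∨n≡0 ∣ gradient k σ ∣ ∣g∣²≡0))
    where
    total≡0 : ℕΣ.sum (dissipation σ) ≡ 0
    total≡0 = ℤP.+-injective (trans (sym (energy σ))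
      (sum≡0 λ v → trans (cong (potential σ v *_) (harmonic v)) (ℤP.*-zeroʳ (potential σ v))))
    ∣g∣²≡0 : ∣ gradient k σ ∣ ℕ.* ∣ gradient k σ ∣ ≡ 0
    ∣g∣²≡0 = ℕP.m*n≡0⇒m≡0 _ (ew (edgeAt k)) {{at ew-pos k}} (sum≡0⇒≡0 (dissipation σ) total≡0 k)

  harmonic⇒potential-constant : ∀ σ → Harmonic σ → ∀ u v → potential σ u ≡ potential σ v
  harmonic⇒potential-constant σ harmonic u v =
    Reachable⇒≡ (potential σ) (λ k → gradient≡0⇒potential≡ k σ (harmonic⇒gradient≡0 σ harmonic k))
                (connected u v)

mainTheorem2 : (Γ : WeightedGraph) →
    let open WeightedGraph Γ in
    (∀ v → applyL Γ (λ u → + charge Γ u) v ≡ + 0)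
    × (∀ (σ′ : Fin n → ℤ) → (∀ v → applyL Γ σ′ v ≡ + 0) →
         ∃ λ (k : ℤ) → ∀ v → σ′ v ≡ k * + charge Γ v)
mainTheorem2 Γ = charge-harmonic Γ , λ σ harmonic →
  constant-product⇒multiple-of-cofactor vw vw-pos σ (harmonic⇒potential-constant Γ σ harmonic)
  where open WeightedGraph Γ
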